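{- Let $G$ be a non-trivial finite abelian group and $m\geqslant2$. Then: (1) each $\gamma_i$ ($1\leqslant i\leqslant m$) is an automorphism of order $2$ of the group $G^m$ satisfying $\mathcal{S}^{\gamma_i}=\mathcal{S}$, and hence is an automorphism of the graph $\mathscr{G}_m(G)$; (2) $\gamma_i\gamma_j=\gamma_j\gamma_i$ whenever $|i-j|>1$, $1\leqslant i,j\leqslant m$; (3) for all $i,j$ with $1\leqslant i,j\leqslant m$ and $i+j\leqslant m$, $\gamma_i\gamma_{i+1}\cdots\gamma_{i+j}$ is an automorphism of $\mathscr{G}_m(G)$ of order $j+2$; in particular each $\gamma_i\gamma_{i+1}$ has order $3$ and $\gamma_1\cdots\gamma_m$ has order $m+1$; (4) the subgroup $\mathbf{\Gamma}_m=\langle\gamma_1,\dots,\gamma_m\rangle$ of $\mathbf{Aut}(\mathscr{G}_m(G))$ is isomorphic to the symmetric group $S_{m+1}$.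
   Context: For a finite group $G$ with identity $e$, $G^\times=G\setminus\{e\}$. For $x\in G^\times$ and $1\leqslant k<l\leqslant m+1$, $\mathbf{x}_{[k,l)}\in G^m$ has $j$-th coordinate $x$ for $k\leqslant j<l$ and $e$ otherwise; $\mathcal{S}$ is the set of all such $\mathbf{x}_{[k,l)}$, and $\mathscr{G}_m(G)=Cay(G^m,\mathcal{S})$ is the graph on $G^m$ with $\mathbf{g}\sim\mathbf{h}$ iff $\mathbf{h}\mathbf{g}^{ -1}\in\mathcal{S}$. Maps act on the right. For $i=1,\dots,m$, $\gamma_i\colon G^m\to G^m$ is given by $(g_1,\dots,g_m)^{\gamma_i}=(g_1,\dots,g_{i-1},g_{i-1}g_i^{ -1}g_{i+1},g_{i+1},\dots,g_m)$, with the convention $g_0=g_{m+1}=e$. -}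

module Defs where

open import Level using (Level; _⊔_)
open import Algebra.Bundles using (AbelianGroup)
open import Data.Nat using (ℕ; zero; suc; _≤_; _<_; _≤?_; _<?_; _+_)
open import Data.Fin using (Fin; toℕ; fromℕ<; _≟_)
open import Data.Fin.Permutation using (Permutation′; _⟨$⟩ʳ_)
open import Data.List using (List; []; _∷_; _++_)
open import Data.Bool using (if_then_else_; _∧_)
open import Data.Product using (Σ; _×_; ∃)
open import Relation.Nullary using (¬_; does; yes; no)
open import Relation.Binary.Bundles using (Setoid)
open import Relation.Binary.PropositionalEquality using (_≡_)
import Relation.Binary.PropositionalEquality as P
open import Function.Bundles using (Inverse)

IsFiniteSetoid : ∀ {c ℓ} → Setoid c ℓ → Set (c ⊔ ℓ)
IsFiniteSetoid S = Σ ℕ λ n → Inverse S (P.setoid (Fin n))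

-- Coordinates of G^m are indexed by Fin m (0-based): the paper's coordinate
-- j (1 ≤ j ≤ m) is our index with toℕ = j - 1.  Likewise γ i (i : Fin m)
-- is the paper's γ_{toℕ i + 1}.
module Cayley {c ℓ} (G : AbelianGroup c ℓ) (m : ℕ) where
  open AbelianGroup G renaming (Carrier to C)

  Vm : Set c
  Vm = Fin m → C

  _≋_ : Vm → Vm → Set ℓ
  u ≋ v = ∀ j → u j ≈ v j

  _·_ : Vm → Vm → Vm
  (u · v) j = u j ∙ v j

  inv : Vm → Vm
  inv u j = u j ⁻¹

  Map : Set c
  Map = Vm → Vm

  _≐_ : Map → Map → Set (c ⊔ ℓ)
  f ≐ g = ∀ v → f v ≋ g v

  idM : Map
  idM v = v

  -- maps act on the right: v^(f g) = (v^f)^g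
  _⨾_ : Map → Map → Map
  (f ⨾ g) v = g (f v)

  iter : Map → ℕ → Map
  iter f zero = idM
  iter f (suc n) = f ⨾ iter f n

  at : Vm → ℕ → C
  at g k with k <? m
  ... | yes p = g (fromℕ< p)
  ... | no _ = ε

  -- paper's 1-based g_k, with g_0 = g_{m+1} = e
  coord : Vm → ℕ → C
  coord g zero = ε
  coord g (suc k) = at g k

  γ : Fin m → Map
  γ i g j with j ≟ i
  ... | yes _ = (coord g (toℕ i) ∙ g i ⁻¹) ∙ coord g (suc (suc (toℕ i)))
  ... | no _ = g j

  -- x_[k,l) with the paper's 1-based k, l: coordinate j (1-based) is x iff k ≤ j < l
  block : C → ℕ → ℕ → Vm
  block x k l j = if does (k ≤? suc (toℕ j)) ∧ does (suc (toℕ j) <? l) then x else ε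

  InS : Vm → Set (c ⊔ ℓ)
  InS v = Σ C λ x → ¬ (x ≈ ε) × Σ ℕ λ k → Σ ℕ λ l →
          1 ≤ k × k < l × l ≤ suc m × v ≋ block x k l

  Adj : Vm → Vm → Set (c ⊔ ℓ)
  Adj g h = InS (h · inv g)

  IsBij : Map → Set (c ⊔ ℓ)
  IsBij f = (∀ {u v} → u ≋ v → f u ≋ f v)
          × (∀ {u v} → f u ≋ f v → u ≋ v)
          × (∀ v → Σ Vm λ u → f u ≋ v)

  IsGroupAut : Map → Set (c ⊔ ℓ)
  IsGroupAut f = IsBij f × (∀ u v → f (u · v) ≋ (f u · f v))

  IsGraphAut : Map → Set (c ⊔ ℓ)
  IsGraphAut f = IsBij f × (∀ g h → (Adj g h → Adj (f g) (f h)) × (Adj (f g) (f h) → Adj g h))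

  HasOrder : Map → ℕ → Set (c ⊔ ℓ)
  HasOrder f n = 1 ≤ n × iter f n ≐ idM × (∀ k → 1 ≤ k → k < n → ¬ (iter f k ≐ idM))

  PreservesS : Map → Set (c ⊔ ℓ)
  PreservesS f = (∀ v → InS v → InS (f v)) × (∀ v → InS v → Σ Vm λ u → InS u × f u ≋ v)

  γℕ : ℕ → Map
  γℕ k with k <? m
  ... | yes p = γ (fromℕ< p)
  ... | no _ = idM

  prodRange : ℕ → ℕ → Map
  prodRange a zero = γℕ a
  prodRange a (suc j) = γℕ a ⨾ prodRange (suc a) j

  word : List (Fin m) → Map
  word [] = idM
  word (a ∷ w) = γ a ⨾ word w

  -- Γ_m = ⟨γ_1,…,γ_m⟩ ≅ S_{m+1}: a map φ from words onto Sym(Fin (m+1)) which is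
  -- multiplicative, constant on words representing the same element of Γ_m,
  -- injective on Γ_m and surjective.
  GammaIsoSym : Set (c ⊔ ℓ)
  GammaIsoSym = Σ (List (Fin m) → Permutation′ (suc m)) λ φ →
      (∀ w w' k → φ (w ++ w') ⟨$⟩ʳ k ≡ φ w' ⟨$⟩ʳ (φ w ⟨$⟩ʳ k))
    × (∀ w w' → word w ≐ word w' → ∀ k → φ w ⟨$⟩ʳ k ≡ φ w' ⟨$⟩ʳ k)
    × (∀ w w' → (∀ k → φ w ⟨$⟩ʳ k ≡ φ w' ⟨$⟩ʳ k) → word w ≐ word w')
    × (∀ (π : Permutation′ (suc m)) → Σ (List (Fin m)) λ w → ∀ k → φ w ⟨$⟩ʳ k ≡ π ⟨$⟩ʳ k)

module Submission where

-- Replace g ∈ Gᵐ by its differences Δ g n = g_n⁻¹ g_{n+1} (0 ≤ n ≤ m, with g_0 = g_{m+1} = e),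
-- which determine g.  In these coordinates γ_i just swaps the differences at i-1 and i, and the
-- elements of 𝒮 are exactly those whose differences form a dipole: x ≠ e at one place, x⁻¹ at
-- another, e elsewhere.  Hence a word in the γ_i acts through the corresponding permutation of
-- {0,…,m}; it is a homomorphism mapping 𝒮 onto 𝒮, and as x ≠ e and m ≥ 2 the dipoles detect the
-- permutation, so a word is the identity exactly when its permutation is.  This identifies Γ_m with
-- the group generated by the adjacent transpositions of {0,…,m}, i.e. S_{m+1}, under which
-- γ_i ⋯ γ_{i+j} becomes a (j+2)-cycle.

open import Defs
open import Algebra.Bundles using (AbelianGroup)
open import Data.Empty using (⊥-elim)
open import Data.Fin as Fin using (Fin; toℕ; fromℕ<)
open import Data.Fin.Properties using (toℕ<n; toℕ-fromℕ<; fromℕ<-toℕ; toℕ-injective)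
open import Data.List using (List; []; _∷_; _++_; map)
open import Data.Nat as ℕ using (ℕ; zero; suc; 2+; _+_; _∸_; _≤_; _<_; ∣_-_∣; z≤n; s≤s; s≤s⁻¹; _≤?_; _<?_)
open import Data.Nat.Properties as ℕₚ
  using (≤-refl; ≤-reflexive; ≤-trans; ≰⇒>; +-comm; +-suc; m+n≤o⇒m≤o; m≤n⇒m≤1+n; m+[n∸m]≡n)
open import Data.Product using (Σ; _×_; _,_; proj₁; proj₂)
open import Function.Base using (id; _∘_)
open import Function.Endo.Propositional ℕ using (_^_; ^-homo)
open import Relation.Nullary using (¬_; yes; no; does)
import Relation.Binary.PropositionalEquality as ≡
open ≡ using (_≡_; _≢_; _≗_)

module AdjacentSwaps where

  open ≡

  swapAdj : ℕ → ℕ → ℕ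
  swapAdj zero    zero          = 1
  swapAdj zero    (suc zero)    = 0
  swapAdj zero    (suc (suc n)) = suc (suc n)
  swapAdj (suc a) zero          = zero
  swapAdj (suc a) (suc n)       = suc (swapAdj a n)

  swapAdj-involutive : ∀ a n → swapAdj a (swapAdj a n) ≡ n
  swapAdj-involutive zero    zero          = refl
  swapAdj-involutive zero    (suc zero)    = refl
  swapAdj-involutive zero    (suc (suc n)) = refl
  swapAdj-involutive (suc a) zero          = refl
  swapAdj-involutive (suc a) (suc n)       = cong suc (swapAdj-involutive a n)

  swapAdj-self : ∀ a → swapAdj a a ≡ suc a
  swapAdj-self zero    = refl
  swapAdj-self (suc a) = cong suc (swapAdj-self a)

  swapAdj-suc : ∀ a → swapAdj a (suc a) ≡ a
  swapAdj-suc zero    = refl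
  swapAdj-suc (suc a) = cong suc (swapAdj-suc a)

  swapAdj-other : ∀ a n → n ≢ a → n ≢ suc a → swapAdj a n ≡ n
  swapAdj-other zero    zero          n≢a _     = ⊥-elim (n≢a refl)
  swapAdj-other zero    (suc zero)    _   n≢1+a = ⊥-elim (n≢1+a refl)
  swapAdj-other zero    (suc (suc n)) _   _     = refl
  swapAdj-other (suc a) zero          _   _     = refl
  swapAdj-other (suc a) (suc n)       n≢a n≢1+a =
    cong suc (swapAdj-other a n (n≢a ∘ cong suc) (n≢1+a ∘ cong suc))

  swapAdj-comm : ∀ a b → 1 < ∣ a - b ∣ → ∀ n → swapAdj a (swapAdj b n) ≡ swapAdj b (swapAdj a n)
  swapAdj-comm zero          zero          ()
  swapAdj-comm zero          (suc zero)    (s≤s ())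
  swapAdj-comm (suc zero)    zero          (s≤s ())
  swapAdj-comm zero          (suc (suc b)) _ zero          = refl
  swapAdj-comm zero          (suc (suc b)) _ (suc zero)    = refl
  swapAdj-comm zero          (suc (suc b)) _ (suc (suc n)) = refl
  swapAdj-comm (suc (suc a)) zero          _ zero          = refl
  swapAdj-comm (suc (suc a)) zero          _ (suc zero)    = refl
  swapAdj-comm (suc (suc a)) zero          _ (suc (suc n)) = refl
  swapAdj-comm (suc a)       (suc b)       _ zero          = refl
  swapAdj-comm (suc a)       (suc b)       far (suc n)     = cong suc (swapAdj-comm a b far n)

  Stable≤ : ℕ → (ℕ → ℕ) → Set
  Stable≤ M f = ∀ {n} → n ≤ M → f n ≤ M

  swapAdj-stable : ∀ {a M} → a < M → Stable≤ M (swapAdj a)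
  swapAdj-stable {zero}  a<M       {zero}        _         = a<M
  swapAdj-stable {zero}  _         {suc zero}    _         = z≤n
  swapAdj-stable {zero}  _         {suc (suc n)} n≤M       = n≤M
  swapAdj-stable {suc a} _         {zero}        _         = z≤n
  swapAdj-stable {suc a} (s≤s a<M) {suc n}       (s≤s n≤M) = s≤s (swapAdj-stable a<M n≤M)

  ^-stable : ∀ {M f} → Stable≤ M f → ∀ k → Stable≤ M (f ^ k)
  ^-stable f-stable zero    = id
  ^-stable f-stable (suc k) = f-stable ∘ ^-stable f-stable k

  ^-cong : ∀ {f g} → f ≗ g → ∀ k → f ^ k ≗ g ^ k
  ^-cong f≗g zero    n = refl
  ^-cong {g = g} f≗g (suc k) n = trans (f≗g _) (cong g (^-cong f≗g k n))

  ^-fixed : ∀ {f x} → f x ≡ x → ∀ k → (f ^ k) x ≡ x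
  ^-fixed fx≡x zero    = refl
  ^-fixed {f} fx≡x (suc k) = trans (cong f (^-fixed fx≡x k)) fx≡x

  ^-periodic-orbit : ∀ {f x} N → (f ^ N) x ≡ x → ∀ k → (f ^ N) ((f ^ k) x) ≡ (f ^ k) x
  ^-periodic-orbit {f} {x} N period k = begin
    (f ^ N) ((f ^ k) x) ≡⟨ cong-app (^-homo f N k) x ⟨
    (f ^ (N + k)) x     ≡⟨ cong (λ t → (f ^ t) x) (+-comm N k) ⟩
    (f ^ (k + N)) x     ≡⟨ cong-app (^-homo f k N) x ⟩
    (f ^ k) ((f ^ N) x) ≡⟨ cong (f ^ k) period ⟩
    (f ^ k) x           ∎
    where open ≡-Reasoning

  shift : (ℕ → ℕ) → ℕ → ℕ
  shift f zero    = zero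
  shift f (suc n) = suc (f n)

  ^-shift : ∀ f k → shift f ^ k ≗ shift (f ^ k)
  ^-shift f zero    zero    = refl
  ^-shift f zero    (suc n) = refl
  ^-shift f (suc k) n       = trans (cong (shift f) (^-shift f k n)) (shift-∘ n)
    where
    shift-∘ : ∀ n → shift f (shift (f ^ k) n) ≡ shift (f ^ suc k) n
    shift-∘ zero    = refl
    shift-∘ (suc n) = refl

  shift-id : ∀ {f} → f ≗ id → shift f ≗ id
  shift-id f≗id zero    = refl
  shift-id f≗id (suc n) = cong suc (f≗id n)

  cycle : ℕ → ℕ → ℕ → ℕ
  cycle a zero    = swapAdj a
  cycle a (suc j) = swapAdj a ∘ cycle (suc a) j

  cycle-suc : ∀ a j → cycle (suc a) j ≗ shift (cycle a j)
  cycle-suc a zero    zero    = refl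
  cycle-suc a zero    (suc n) = refl
  cycle-suc a (suc j) zero    = cong (swapAdj (suc a)) (cycle-suc (suc a) j zero)
  cycle-suc a (suc j) (suc n) = cong (swapAdj (suc a)) (cycle-suc (suc a) j (suc n))

  cycle-stable : ∀ {M} a j → a + j < M → Stable≤ M (cycle a j)
  cycle-stable a zero    a+0<M = swapAdj-stable (m+n≤o⇒m≤o (suc a) a+0<M)
  cycle-stable {M} a (suc j) a+j<M =
    swapAdj-stable (m+n≤o⇒m≤o (suc a) a+j<M) ∘ cycle-stable (suc a) j (subst (_< M) (+-suc a j) a+j<M)

  cycle₀-below : ∀ j n → n ≤ j → cycle 0 j n ≡ suc n
  cycle₀-below zero    zero    _         = refl
  cycle₀-below (suc j) zero    _         = cong (swapAdj 0) (cycle-suc 0 j 0)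
  cycle₀-below (suc j) (suc n) (s≤s n≤j) =
    cong (swapAdj 0) (trans (cycle-suc 0 j (suc n)) (cong suc (cycle₀-below j n n≤j)))

  cycle₀-top : ∀ j → cycle 0 j (suc j) ≡ 0
  cycle₀-top zero    = refl
  cycle₀-top (suc j) = cong (swapAdj 0) (trans (cycle-suc 0 j (suc (suc j))) (cong suc (cycle₀-top j)))

  cycle₀-above : ∀ j n → suc j < n → cycle 0 j n ≡ n
  cycle₀-above zero    (suc zero)    (s≤s ())
  cycle₀-above zero    (suc (suc n)) _                = refl
  cycle₀-above (suc j) (suc (suc zero)) (s≤s (s≤s ()))
  cycle₀-above (suc j) (suc (suc (suc n))) (s≤s 2+j<n) =
    cong (swapAdj 0) (trans (cycle-suc 0 j (suc (suc (suc n)))) (cong suc (cycle₀-above j (suc (suc n)) 2+j<n)))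

  cycle-orbit : ∀ a j k → k ≤ suc j → (cycle a j ^ k) a ≡ a + k
  cycle-orbit zero    j zero    _         = refl
  cycle-orbit zero    j (suc k) (s≤s k≤j) =
    trans (cong (cycle 0 j) (cycle-orbit 0 j k (m≤n⇒m≤1+n k≤j))) (cycle₀-below j k k≤j)
  cycle-orbit (suc a) j k       k≤1+j     = begin
    (cycle (suc a) j ^ k) (suc a)      ≡⟨ ^-cong (cycle-suc a j) k (suc a) ⟩
    (shift (cycle a j) ^ k) (suc a)    ≡⟨ ^-shift (cycle a j) k (suc a) ⟩
    suc ((cycle a j ^ k) a)            ≡⟨ cong suc (cycle-orbit a j k k≤1+j) ⟩
    suc (a + k)                        ∎
    where open ≡-Reasoning

  cycle-period : ∀ a j → cycle a j ^ (2 + j) ≗ id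
  cycle-period zero j n with n ≤? suc j
  ... | yes n≤1+j = begin
    (f ^ (2 + j)) n             ≡⟨ cong (f ^ (2 + j)) (sym (cycle-orbit 0 j n n≤1+j)) ⟩
    (f ^ (2 + j)) ((f ^ n) 0)   ≡⟨ ^-periodic-orbit (2 + j) 0-returns n ⟩
    (f ^ n) 0                   ≡⟨ cycle-orbit 0 j n n≤1+j ⟩
    n                           ∎
    where
    open ≡-Reasoning
    f = cycle 0 j
    0-returns : (f ^ (2 + j)) 0 ≡ 0
    0-returns = trans (cong f (cycle-orbit 0 j (suc j) ≤-refl)) (cycle₀-top j)
  ... | no n≰1+j = ^-fixed {cycle 0 j} (cycle₀-above j n (≰⇒> n≰1+j)) (2 + j)
  cycle-period (suc a) j n =
    trans (^-cong (cycle-suc a j) (2 + j) n)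
          (trans (^-shift (cycle a j) (2 + j) n) (shift-id (cycle-period a j) n))

  avoid-two : ∀ p q → Σ ℕ λ r → r ≤ 2 × r ≢ p × r ≢ q
  avoid-two zero          zero          = 1 , s≤s z≤n , (λ ()) , (λ ())
  avoid-two zero          (suc zero)    = 2 , ≤-refl , (λ ()) , (λ ())
  avoid-two zero          (suc (suc _)) = 1 , s≤s z≤n , (λ ()) , (λ ())
  avoid-two (suc zero)    zero          = 2 , ≤-refl , (λ ()) , (λ ())
  avoid-two (suc zero)    (suc _)       = 0 , z≤n , (λ ()) , (λ ())
  avoid-two (suc (suc _)) zero          = 1 , s≤s z≤n , (λ ()) , (λ ())
  avoid-two (suc (suc _)) (suc _)       = 0 , z≤n , (λ ()) , (λ ())

module TranspositionWords where

  open AdjacentSwaps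
  open ≡
  open import Data.Fin using (zero; suc)
  open import Data.Fin.Permutation
    using (Permutation′; _⟨$⟩ʳ_; _⟨$⟩ˡ_; _≈_; permutation; flip; _∘ₚ_; lift₀; remove;
           lift₀-remove; lift₀-cong; lift₀-id; inverseˡ; inverseʳ)
    renaming (id to idₚ)

  private variable n : ℕ

  swapFin : Fin n → Fin (suc n) → Fin (suc n)
  swapFin zero    zero          = suc zero
  swapFin zero    (suc zero)    = zero
  swapFin zero    (suc (suc k)) = suc (suc k)
  swapFin (suc a) zero          = zero
  swapFin (suc a) (suc k)       = suc (swapFin a k)

  swapFin-involutive : ∀ (a : Fin n) k → swapFin a (swapFin a k) ≡ k
  swapFin-involutive zero    zero          = refl
  swapFin-involutive zero    (suc zero)    = refl
  swapFin-involutive zero    (suc (suc k)) = refl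
  swapFin-involutive (suc a) zero          = refl
  swapFin-involutive (suc a) (suc k)       = cong suc (swapFin-involutive a k)

  toℕ-swapFin : ∀ (a : Fin n) k → toℕ (swapFin a k) ≡ swapAdj (toℕ a) (toℕ k)
  toℕ-swapFin zero    zero          = refl
  toℕ-swapFin zero    (suc zero)    = refl
  toℕ-swapFin zero    (suc (suc k)) = refl
  toℕ-swapFin (suc a) zero          = refl
  toℕ-swapFin (suc a) (suc k)       = cong suc (toℕ-swapFin a k)

  transposition : Fin n → Permutation′ (suc n)
  transposition a = permutation (swapFin a) (swapFin a) (swapFin-involutive a) (swapFin-involutive a)

  evalWord : List (Fin n) → Permutation′ (suc n)
  evalWord []      = idₚ
  evalWord (a ∷ w) = transposition a ∘ₚ evalWord w

  evalWord-++ : ∀ (w w′ : List (Fin n)) k → evalWord (w ++ w′) ⟨$⟩ʳ k ≡ evalWord w′ ⟨$⟩ʳ (evalWord w ⟨$⟩ʳ k)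
  evalWord-++ []      w′ k = refl
  evalWord-++ (a ∷ w) w′ k = evalWord-++ w w′ (swapFin a k)

  evalWord-map-suc : ∀ (w : List (Fin n)) → evalWord (map suc w) ≈ lift₀ (evalWord w)
  evalWord-map-suc []      k       = sym (lift₀-id k)
  evalWord-map-suc (a ∷ w) zero    = evalWord-map-suc w zero
  evalWord-map-suc (a ∷ w) (suc k) = evalWord-map-suc w (suc (swapFin a k))

  swapsℕ : List (Fin n) → ℕ → ℕ
  swapsℕ []      = id
  swapsℕ (a ∷ w) = swapAdj (toℕ a) ∘ swapsℕ w

  toℕ-evalWord⁻¹ : ∀ (w : List (Fin n)) k → toℕ (evalWord w ⟨$⟩ˡ k) ≡ swapsℕ w (toℕ k)
  toℕ-evalWord⁻¹ []      k = refl
  toℕ-evalWord⁻¹ (a ∷ w) k = trans (toℕ-swapFin a _) (cong (swapAdj (toℕ a)) (toℕ-evalWord⁻¹ w k))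

  wordToZero : Fin (suc n) → List (Fin n)
  wordToZero zero              = []
  wordToZero {suc n} (suc p)   = map suc (wordToZero p) ++ (zero ∷ [])

  wordToZero-sends : ∀ (p : Fin (suc n)) → evalWord (wordToZero p) ⟨$⟩ʳ p ≡ zero
  wordToZero-sends zero              = refl
  wordToZero-sends {suc n} (suc p)   = begin
    evalWord (w ++ (zero ∷ [])) ⟨$⟩ʳ suc p              ≡⟨ evalWord-++ w (zero ∷ []) (suc p) ⟩
    swapFin zero (evalWord w ⟨$⟩ʳ suc p)                ≡⟨ cong (swapFin zero) (evalWord-map-suc (wordToZero p) (suc p)) ⟩
    swapFin zero (suc (evalWord (wordToZero p) ⟨$⟩ʳ p)) ≡⟨ cong (swapFin zero ∘ suc) (wordToZero-sends p) ⟩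
    zero                                               ∎
    where
    open ≡-Reasoning
    w = map suc (wordToZero p)

  evalWord-surjective : ∀ n (π : Permutation′ (suc n)) → Σ (List (Fin n)) λ w → evalWord w ≈ π
  evalWord-surjective zero    π = [] , λ { zero → sym (lemma (π ⟨$⟩ʳ zero)) }
    where lemma : (k : Fin 1) → k ≡ zero
          lemma zero = refl
  evalWord-surjective (suc n) π = wordToZero p ++ map suc w , λ k → begin
    evalWord (wordToZero p ++ map suc w) ⟨$⟩ʳ k ≡⟨ evalWord-++ (wordToZero p) (map suc w) k ⟩
    evalWord (map suc w) ⟨$⟩ʳ (ρ ⟨$⟩ʳ k)        ≡⟨ evalWord-map-suc w _ ⟩
    lift₀ (evalWord w) ⟨$⟩ʳ (ρ ⟨$⟩ʳ k)          ≡⟨ lift₀-cong (evalWord w) (remove zero π′) w≈ _ ⟩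
    lift₀ (remove zero π′) ⟨$⟩ʳ (ρ ⟨$⟩ʳ k)      ≡⟨ lift₀-remove π′ π′-fixes-zero _ ⟩
    π ⟨$⟩ʳ (ρ ⟨$⟩ˡ (ρ ⟨$⟩ʳ k))                  ≡⟨ cong (π ⟨$⟩ʳ_) (inverseˡ ρ) ⟩
    π ⟨$⟩ʳ k                                    ∎
    where
    open ≡-Reasoning
    p = π ⟨$⟩ˡ zero
    ρ = evalWord (wordToZero p)
    π′ = flip ρ ∘ₚ π
    π′-fixes-zero : π′ ⟨$⟩ʳ zero ≡ zero
    π′-fixes-zero = begin
      π ⟨$⟩ʳ (ρ ⟨$⟩ˡ zero)          ≡⟨ cong (λ t → π ⟨$⟩ʳ (ρ ⟨$⟩ˡ t)) (wordToZero-sends p) ⟨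
      π ⟨$⟩ʳ (ρ ⟨$⟩ˡ (ρ ⟨$⟩ʳ p))    ≡⟨ cong (π ⟨$⟩ʳ_) (inverseˡ ρ) ⟩
      π ⟨$⟩ʳ p                      ≡⟨ inverseʳ π ⟩
      zero                          ∎
    rest = evalWord-surjective n (remove zero π′)
    w = proj₁ rest
    w≈ = proj₂ rest

  flip-cong : ∀ {π ρ : Permutation′ n} → π ≈ ρ → flip π ≈ flip ρ
  flip-cong {π = π} {ρ} π≈ρ i = begin
    π ⟨$⟩ˡ i                      ≡⟨ inverseˡ ρ ⟨
    ρ ⟨$⟩ˡ (ρ ⟨$⟩ʳ (π ⟨$⟩ˡ i))    ≡⟨ cong (ρ ⟨$⟩ˡ_) (π≈ρ _) ⟨
    ρ ⟨$⟩ˡ (π ⟨$⟩ʳ (π ⟨$⟩ˡ i))    ≡⟨ cong (ρ ⟨$⟩ˡ_) (inverseʳ π) ⟩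
    ρ ⟨$⟩ˡ i                      ∎
    where open ≡-Reasoning

  swapsℕ-stable : ∀ (w : List (Fin n)) → Stable≤ n (swapsℕ w)
  swapsℕ-stable []      = id
  swapsℕ-stable (a ∷ w) = swapAdj-stable (toℕ<n a) ∘ swapsℕ-stable w

  evalWord-≈⇒swapsℕ : ∀ (w w′ : List (Fin n)) → evalWord w ≈ evalWord w′ →
                      ∀ {i} → i ≤ n → swapsℕ w i ≡ swapsℕ w′ i
  evalWord-≈⇒swapsℕ w w′ w≈w′ {i} i≤n = begin
    swapsℕ w i                        ≡⟨ cong (swapsℕ w) (toℕ-fromℕ< (s≤s i≤n)) ⟨
    swapsℕ w (toℕ k)                  ≡⟨ toℕ-evalWord⁻¹ w k ⟨
    toℕ (evalWord w ⟨$⟩ˡ k)           ≡⟨ cong toℕ (flip-cong {π = evalWord w} {evalWord w′} w≈w′ k) ⟩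
    toℕ (evalWord w′ ⟨$⟩ˡ k)          ≡⟨ toℕ-evalWord⁻¹ w′ k ⟩
    swapsℕ w′ (toℕ k)                 ≡⟨ cong (swapsℕ w′) (toℕ-fromℕ< (s≤s i≤n)) ⟩
    swapsℕ w′ i                       ∎
    where
    open ≡-Reasoning
    k = fromℕ< (s≤s i≤n)

  swapsℕ⇒evalWord-≈ : ∀ (w w′ : List (Fin n)) → (∀ {i} → i ≤ n → swapsℕ w i ≡ swapsℕ w′ i) →
                      evalWord w ≈ evalWord w′
  swapsℕ⇒evalWord-≈ w w′ agree = flip-cong {π = flip (evalWord w)} {flip (evalWord w′)} λ k → toℕ-injective (begin
    toℕ (evalWord w ⟨$⟩ˡ k)   ≡⟨ toℕ-evalWord⁻¹ w k ⟩
    swapsℕ w (toℕ k)          ≡⟨ agree (s≤s⁻¹ (toℕ<n k)) ⟩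
    swapsℕ w′ (toℕ k)         ≡⟨ toℕ-evalWord⁻¹ w′ k ⟨
    toℕ (evalWord w′ ⟨$⟩ˡ k)  ∎)
    where open ≡-Reasoning

module Differences {c ℓ} (G : AbelianGroup c ℓ) (m : ℕ) where

  open AdjacentSwaps
  open TranspositionWords
  open import Data.Bool using (if_then_else_; _∧_)
  open import Data.Bool.Properties using (∧-zeroʳ)
  open import Data.Fin.Permutation using () renaming (_≈_ to _≈ₚ_)
  open import Function.Bundles using (_⇔_; mk⇔)
  open import Level using (_⊔_)
  open import Relation.Binary.Definitions using (tri<; tri≈; tri>)
  open import Relation.Nullary.Decidable using (dec-true; dec-false; does-⇔)

  open AbelianGroup G renaming (Carrier to C)
  open Cayley G m
  open import Algebra.Properties.AbelianGroup G
  open import Algebra.Properties.CommutativeSemigroup commutativeSemigroup using (interchange)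
  open import Relation.Binary.Reasoning.Setoid setoid

  ≡⇒≈ : ∀ {a b} → a ≡ b → a ≈ b
  ≡⇒≈ ≡.refl = refl

  infixr 6 _\\_
  _\\_ : C → C → C
  a \\ b = a ⁻¹ ∙ b

  \\-∙-interchange : ∀ a b c d → (a ∙ b) \\ (c ∙ d) ≈ (a \\ c) ∙ (b \\ d)
  \\-∙-interchange a b c d = trans (∙-congʳ (sym (⁻¹-∙-comm a b))) (interchange _ _ _ _)

  \\-cancelˡ : ∀ a b d → a \\ ((a ∙ b ⁻¹) ∙ d) ≈ b \\ d
  \\-cancelˡ a b d = trans (∙-congˡ (assoc _ _ _)) (\\-leftDividesʳ a _)

  \\-cancelʳ : ∀ a b d → ((a ∙ b ⁻¹) ∙ d) \\ d ≈ a \\ b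
  \\-cancelʳ a b d = begin
    ((a ∙ b ⁻¹) ∙ d) ⁻¹ ∙ d ≈⟨ ∙-congʳ (⁻¹-∙-comm _ _) ⟨
    ((a ∙ b ⁻¹) ⁻¹ ∙ d ⁻¹) ∙ d ≈⟨ //-rightDividesˡ d _ ⟩
    (a ∙ b ⁻¹) ⁻¹ ≈⟨ ⁻¹-∙-comm _ _ ⟨
    a ⁻¹ ∙ b ⁻¹ ⁻¹ ≈⟨ ∙-congˡ (⁻¹-involutive b) ⟩
    a \\ b ∎

  at-< : ∀ g {k} (k<m : k < m) → at g k ≡ g (fromℕ< k<m)
  at-< g {k} k<m with k <? m
  ... | yes _   = ≡.refl
  ... | no k≮m = ⊥-elim (k≮m k<m)

  coord-toℕ : ∀ g j → coord g (suc (toℕ j)) ≡ g j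
  coord-toℕ g j = ≡.trans (at-< g (toℕ<n j)) (≡.cong g (fromℕ<-toℕ j _))

  coord-cong : ∀ {u v} → u ≋ v → ∀ n → coord u n ≈ coord v n
  coord-cong u≋v zero    = refl
  coord-cong u≋v (suc k) with k <? m
  ... | yes k<m = u≋v (fromℕ< k<m)
  ... | no _    = refl

  coord-· : ∀ u v n → coord (u · v) n ≈ coord u n ∙ coord v n
  coord-· u v zero    = sym (identityʳ ε)
  coord-· u v (suc k) with k <? m
  ... | yes _ = refl
  ... | no _  = sym (identityʳ ε)

  coord-inv : ∀ u n → coord (inv u) n ≈ coord u n ⁻¹
  coord-inv u zero    = sym ε⁻¹≈ε
  coord-inv u (suc k) with k <? m
  ... | yes _ = refl
  ... | no _  = sym ε⁻¹≈ε

  Δ : Vm → ℕ → C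
  Δ g n = coord g n \\ coord g (suc n)

  Δ-cong : ∀ {u v} → u ≋ v → ∀ n → Δ u n ≈ Δ v n
  Δ-cong u≋v n = ∙-cong (⁻¹-cong (coord-cong u≋v n)) (coord-cong u≋v (suc n))

  Δ-· : ∀ u v n → Δ (u · v) n ≈ Δ u n ∙ Δ v n
  Δ-· u v n = trans (∙-cong (⁻¹-cong (coord-· u v n)) (coord-· u v (suc n))) (\\-∙-interchange _ _ _ _)

  Δ-inv : ∀ u n → Δ (inv u) n ≈ Δ u n ⁻¹
  Δ-inv u n = trans (∙-cong (⁻¹-cong (coord-inv u n)) (coord-inv u (suc n))) (⁻¹-∙-comm _ _)

  Δ-injective : ∀ {u v} → (∀ n → n ≤ m → Δ u n ≈ Δ v n) → u ≋ v
  Δ-injective {u} {v} Δu≈Δv j = begin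
    u j                   ≡⟨ coord-toℕ u j ⟨
    coord u (suc (toℕ j)) ≈⟨ coords-agree (suc (toℕ j)) (toℕ<n j) ⟩
    coord v (suc (toℕ j)) ≡⟨ coord-toℕ v j ⟩
    v j                   ∎
    where
    coords-agree : ∀ n → n ≤ m → coord u n ≈ coord v n
    coords-agree zero    _       = refl
    coords-agree (suc n) 1+n≤m = begin
      coord u (suc n)         ≈⟨ \\-leftDividesˡ (coord u n) _ ⟨
      coord u n ∙ Δ u n       ≈⟨ ∙-cong (coords-agree n n≤m) (Δu≈Δv n n≤m) ⟩
      coord v n ∙ Δ v n       ≈⟨ \\-leftDividesˡ (coord v n) _ ⟩
      coord v (suc n)         ∎
      where n≤m = ℕₚ.<⇒≤ 1+n≤m

  ActsOnΔ : Map → (ℕ → ℕ) → Set (c ⊔ ℓ)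
  ActsOnΔ f σ = ∀ g n → Δ (f g) n ≈ Δ g (σ n)

  coord-γ-self : ∀ a g → coord (γ a g) (suc (toℕ a)) ≡ (coord g (toℕ a) ∙ g a ⁻¹) ∙ coord g (suc (suc (toℕ a)))
  coord-γ-self a g = ≡.trans (coord-toℕ (γ a g) a) (γ-self)
    where
    γ-self : γ a g a ≡ (coord g (toℕ a) ∙ g a ⁻¹) ∙ coord g (suc (suc (toℕ a)))
    γ-self with a Fin.≟ a
    ... | yes _  = ≡.refl
    ... | no a≢a = ⊥-elim (a≢a ≡.refl)

  coord-γ-other : ∀ a g n → n ≢ suc (toℕ a) → coord (γ a g) n ≡ coord g n
  coord-γ-other a g zero    _ = ≡.refl
  coord-γ-other a g (suc k) n≢1+a with k <? m
  ... | no _    = ≡.refl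
  ... | yes k<m with fromℕ< k<m Fin.≟ a
  ...   | yes k≡a = ⊥-elim (n≢1+a (≡.cong suc (≡.trans (≡.sym (toℕ-fromℕ< k<m)) (≡.cong toℕ k≡a))))
  ...   | no _    = ≡.refl

  γ-acts : ∀ a → ActsOnΔ (γ a) (swapAdj (toℕ a))
  γ-acts a g n with n ℕ.≟ toℕ a | n ℕ.≟ suc (toℕ a)
  ... | yes ≡.refl | _ = begin
    coord (γ a g) A \\ coord (γ a g) (suc A)
      ≡⟨ ≡.cong₂ _\\_ (coord-γ-other a g A (ℕₚ.1+n≢n ∘ ≡.sym)) (coord-γ-self a g) ⟩
    coord g A \\ ((coord g A ∙ g a ⁻¹) ∙ coord g (2+ A)) ≈⟨ \\-cancelˡ _ _ _ ⟩
    g a \\ coord g (2+ A)                                ≡⟨ ≡.cong (_\\ coord g (2+ A)) (coord-toℕ g a) ⟨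
    Δ g (suc A)                                          ≡⟨ ≡.cong (Δ g) (swapAdj-self A) ⟨
    Δ g (swapAdj A A)                                    ∎
    where A = toℕ a
  ... | no _ | yes ≡.refl = begin
    coord (γ a g) (suc A) \\ coord (γ a g) (2+ A)
      ≡⟨ ≡.cong₂ _\\_ (coord-γ-self a g) (coord-γ-other a g (2+ A) ℕₚ.1+n≢n) ⟩
    ((coord g A ∙ g a ⁻¹) ∙ coord g (2+ A)) \\ coord g (2+ A) ≈⟨ \\-cancelʳ _ _ _ ⟩
    coord g A \\ g a                                         ≡⟨ ≡.cong (coord g A \\_) (coord-toℕ g a) ⟨
    Δ g A                                                    ≡⟨ ≡.cong (Δ g) (swapAdj-suc A) ⟨
    Δ g (swapAdj A (suc A))                                  ∎
    where A = toℕ a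
  ... | no n≢a | no n≢1+a = begin
    Δ (γ a g) n
      ≡⟨ ≡.cong₂ _\\_ (coord-γ-other a g n n≢1+a) (coord-γ-other a g (suc n) (n≢a ∘ ℕₚ.suc-injective)) ⟩
    Δ g n                      ≡⟨ ≡.cong (Δ g) (swapAdj-other (toℕ a) n n≢a n≢1+a) ⟨
    Δ g (swapAdj (toℕ a) n)    ∎

  ActsOnΔ-id : ActsOnΔ idM id
  ActsOnΔ-id g n = refl

  ActsOnΔ-⨾ : ∀ {f h σ τ} → ActsOnΔ f σ → ActsOnΔ h τ → ActsOnΔ (f ⨾ h) (σ ∘ τ)
  ActsOnΔ-⨾ {f} f-acts h-acts g n = trans (h-acts (f g) n) (f-acts g _)

  ActsOnΔ-iter : ∀ {f σ} → ActsOnΔ f σ → ∀ k → ActsOnΔ (iter f k) (σ ^ k)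
  ActsOnΔ-iter f-acts zero    = ActsOnΔ-id
  ActsOnΔ-iter f-acts (suc k) = ActsOnΔ-⨾ f-acts (ActsOnΔ-iter f-acts k)

  γℕ-< : ∀ {a} (a<m : a < m) → γℕ a ≡ γ (fromℕ< a<m)
  γℕ-< {a} a<m with a <? m
  ... | yes _   = ≡.refl
  ... | no a≮m = ⊥-elim (a≮m a<m)

  γℕ-acts : ∀ {a} → a < m → ActsOnΔ (γℕ a) (swapAdj a)
  γℕ-acts {a} a<m g n = begin
    Δ (γℕ a g) n                             ≡⟨ ≡.cong (λ f → Δ (f g) n) (γℕ-< a<m) ⟩
    Δ (γ (fromℕ< a<m) g) n                   ≈⟨ γ-acts (fromℕ< a<m) g n ⟩
    Δ g (swapAdj (toℕ (fromℕ< a<m)) n)       ≡⟨ ≡.cong (λ t → Δ g (swapAdj t n)) (toℕ-fromℕ< a<m) ⟩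
    Δ g (swapAdj a n)                        ∎

  prodRange-acts : ∀ a j → a ℕ.+ j < m → ActsOnΔ (prodRange a j) (cycle a j)
  prodRange-acts a zero    a+0<m = γℕ-acts (m+n≤o⇒m≤o (suc a) a+0<m)
  prodRange-acts a (suc j) a+j<m =
    ActsOnΔ-⨾ (γℕ-acts (m+n≤o⇒m≤o (suc a) a+j<m))
              (prodRange-acts (suc a) j (≡.subst (_< m) (+-suc a j) a+j<m))

  word-acts : ∀ w → ActsOnΔ (word w) (swapsℕ w)
  word-acts []      = ActsOnΔ-id
  word-acts (a ∷ w) = ActsOnΔ-⨾ (γ-acts a) (word-acts w)

  dipole : C → ℕ → ℕ → ℕ → C
  dipole x p q n = if does (n ℕ.≟ p) then x else if does (n ℕ.≟ q) then x ⁻¹ else ε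

  dipole-at-p : ∀ x p q → dipole x p q p ≡ x
  dipole-at-p x p q rewrite dec-true (p ℕ.≟ p) ≡.refl = ≡.refl

  dipole-at-q : ∀ x {p q} → q ≢ p → dipole x p q q ≡ x ⁻¹
  dipole-at-q x {p} {q} q≢p rewrite dec-false (q ℕ.≟ p) q≢p | dec-true (q ℕ.≟ q) ≡.refl = ≡.refl

  dipole-elsewhere : ∀ x {p q n} → n ≢ p → n ≢ q → dipole x p q n ≡ ε
  dipole-elsewhere x {p} {q} {n} n≢p n≢q rewrite dec-false (n ℕ.≟ p) n≢p | dec-false (n ℕ.≟ q) n≢q = ≡.refl

  dipole-swap : ∀ x {p q} → p ≢ q → ∀ n → dipole x p q n ≈ dipole (x ⁻¹) q p n
  dipole-swap x {p} {q} p≢q n with n ℕ.≟ p | n ℕ.≟ q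
  ... | yes ≡.refl | _ = begin
    dipole x n q n         ≡⟨ dipole-at-p x n q ⟩
    x                      ≈⟨ ⁻¹-involutive x ⟨
    x ⁻¹ ⁻¹                ≡⟨ dipole-at-q (x ⁻¹) p≢q ⟨
    dipole (x ⁻¹) q n n    ∎
  ... | no n≢p | yes ≡.refl = ≡⇒≈ (≡.trans (dipole-at-q x n≢p) (≡.sym (dipole-at-p (x ⁻¹) n p)))
  ... | no n≢p | no n≢q =
    ≡⇒≈ (≡.trans (dipole-elsewhere x n≢p n≢q) (≡.sym (dipole-elsewhere (x ⁻¹) n≢q n≢p)))

  dipole-∘-involution : ∀ x p q {ψ : ℕ → ℕ} → (∀ n → ψ (ψ n) ≡ n) →
                        ∀ n → dipole x p q (ψ n) ≡ dipole x (ψ p) (ψ q) n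
  dipole-∘-involution x p q {ψ} ψ-involutive n =
    ≡.cong₂ (λ b b′ → if b then x else if b′ then x ⁻¹ else ε)
            (does-⇔ (moved p) (ψ n ℕ.≟ p) (n ℕ.≟ ψ p)) (does-⇔ (moved q) (ψ n ℕ.≟ q) (n ℕ.≟ ψ q))
    where
    moved : ∀ r → (ψ n ≡ r) ⇔ (n ≡ ψ r)
    moved r = mk⇔ (λ e → ≡.trans (≡.sym (ψ-involutive n)) (≡.cong ψ e))
                  (λ e → ≡.trans (≡.cong ψ e) (ψ-involutive r))

  ε\\y≈y : ∀ y → ε \\ y ≈ y
  ε\\y≈y y = trans (∙-congʳ ε⁻¹≈ε) (identityˡ y)

  Δ-from-coords : ∀ {v n a b d e} → coord v n ≡ a → coord v (suc n) ≡ b → a \\ b ≈ d → e ≡ d → Δ v n ≈ e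
  Δ-from-coords ≡.refl ≡.refl a\\b≈d ≡.refl = a\\b≈d

  module _ (x : C) {p q : ℕ} (p<q : p < q) (q≤m : q ≤ m) where

    private
      coord-block-suc : ∀ {t} (t<m : t < m) →
        coord (block x (suc p) (suc q)) (suc t) ≡ (if does (suc p ≤? suc t) ∧ does (suc t <? suc q) then x else ε)
      coord-block-suc {t} t<m = ≡.trans (at-< (block x (suc p) (suc q)) t<m)
        (≡.cong (λ s → if does (suc p ≤? suc s) ∧ does (suc s <? suc q) then x else ε) (toℕ-fromℕ< t<m))

    block-inside : ∀ {n} → p < n → n ≤ q → coord (block x (suc p) (suc q)) n ≡ x
    block-inside {suc t} p<n n≤q
      rewrite coord-block-suc (≤-trans n≤q q≤m)
            | dec-true (suc p ≤? suc t) p<n | dec-true (suc t <? suc q) (s≤s n≤q) = ≡.refl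

    block-below : ∀ {n} → n ≤ p → coord (block x (suc p) (suc q)) n ≡ ε
    block-below {zero}  _   = ≡.refl
    block-below {suc t} n≤p
      rewrite coord-block-suc (≤-trans n≤p (≤-trans (ℕₚ.<⇒≤ p<q) q≤m))
            | dec-false (suc p ≤? suc t) (ℕₚ.<⇒≱ n≤p ∘ s≤s⁻¹) = ≡.refl

    block-above : ∀ {n} → q < n → coord (block x (suc p) (suc q)) n ≡ ε
    block-above {suc t} q<n with t <? m
    ... | no _    = ≡.refl
    ... | yes t<m
      rewrite ≡.cong (λ s → if does (suc p ≤? suc s) ∧ does (suc s <? suc q) then x else ε) (toℕ-fromℕ< t<m)
            | dec-false (suc t <? suc q) (ℕₚ.<⇒≱ q<n ∘ s≤s⁻¹)
            | ∧-zeroʳ (does (suc p ≤? suc t)) = ≡.refl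

    Δ-block : ∀ n → Δ (block x (suc p) (suc q)) n ≈ dipole x p q n
    Δ-block n with ℕ.<-cmp n p
    ... | tri< n<p _ _ =
      Δ-from-coords (block-below (ℕₚ.<⇒≤ n<p)) (block-below n<p) (ε\\y≈y ε)
            (dipole-elsewhere x (ℕₚ.<⇒≢ n<p) (ℕₚ.<⇒≢ (ℕₚ.<-trans n<p p<q)))
    ... | tri≈ _ ≡.refl _ =
      Δ-from-coords (block-below ≤-refl) (block-inside ≤-refl p<q) (ε\\y≈y x) (dipole-at-p x p q)
    ... | tri> _ _ p<n with ℕ.<-cmp n q
    ...   | tri< n<q _ _ =
      Δ-from-coords (block-inside p<n (ℕₚ.<⇒≤ n<q)) (block-inside (m≤n⇒m≤1+n p<n) n<q) (inverseˡ x)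
            (dipole-elsewhere x (ℕₚ.>⇒≢ p<n) (ℕₚ.<⇒≢ n<q))
    ...   | tri≈ _ ≡.refl _ =
      Δ-from-coords (block-inside p<n ≤-refl) (block-above ≤-refl) (identityʳ _) (dipole-at-q x (ℕₚ.>⇒≢ p<q))
    ...   | tri> _ _ q<n =
      Δ-from-coords (block-above q<n) (block-above (m≤n⇒m≤1+n q<n)) (ε\\y≈y ε)
            (dipole-elsewhere x (ℕₚ.>⇒≢ p<n) (ℕₚ.>⇒≢ q<n))

  InS-resp : ∀ {u v} → u ≋ v → InS v → InS u
  InS-resp u≋v (x , x≉ε , k , l , 1≤k , k<l , l≤1+m , v≋block) =
    x , x≉ε , k , l , 1≤k , k<l , l≤1+m , λ j → trans (u≋v j) (v≋block j)

  dipole-realised : ∀ {x} → ¬ x ≈ ε → ∀ {p q} → p ≢ q → p ≤ m → q ≤ m →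
                    Σ Vm λ v → InS v × (∀ n → Δ v n ≈ dipole x p q n)
  dipole-realised {x} x≉ε {p} {q} p≢q p≤m q≤m with ℕ.<-cmp p q
  ... | tri< p<q _ _ =
    block x (suc p) (suc q) , (x , x≉ε , suc p , suc q , s≤s z≤n , s≤s p<q , s≤s q≤m , λ _ → refl) ,
    Δ-block x p<q q≤m
  ... | tri≈ _ p≡q _ = ⊥-elim (p≢q p≡q)
  ... | tri> _ _ q<p =
    block (x ⁻¹) (suc q) (suc p) , (x ⁻¹ , x⁻¹≉ε , suc q , suc p , s≤s z≤n , s≤s q<p , s≤s p≤m , λ _ → refl) ,
    λ n → trans (Δ-block (x ⁻¹) q<p p≤m n) (sym (dipole-swap x p≢q n))
    where
    x⁻¹≉ε : ¬ x ⁻¹ ≈ ε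
    x⁻¹≉ε x⁻¹≈ε = x≉ε (trans (sym (⁻¹-involutive x)) (trans (⁻¹-cong x⁻¹≈ε) ε⁻¹≈ε))

  module _ {f σ} (f-acts : ActsOnΔ f σ) where

    ActsOnΔ-cong : ∀ {u v} → u ≋ v → f u ≋ f v
    ActsOnΔ-cong {u} {v} u≋v = Δ-injective λ n _ → trans (f-acts u n) (trans (Δ-cong u≋v (σ n)) (sym (f-acts v n)))

    ActsOnΔ-hom : ∀ u v → f (u · v) ≋ (f u · f v)
    ActsOnΔ-hom u v = Δ-injective λ n _ → begin
      Δ (f (u · v)) n           ≈⟨ f-acts (u · v) n ⟩
      Δ (u · v) (σ n)           ≈⟨ Δ-· u v (σ n) ⟩
      Δ u (σ n) ∙ Δ v (σ n)     ≈⟨ ∙-cong (f-acts u n) (f-acts v n) ⟨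
      Δ (f u) n ∙ Δ (f v) n     ≈⟨ Δ-· (f u) (f v) n ⟨
      Δ (f u · f v) n           ∎

    ActsOnΔ-quotient : ∀ g h → f (h · inv g) ≋ (f h · inv (f g))
    ActsOnΔ-quotient g h = Δ-injective λ n _ → begin
      Δ (f (h · inv g)) n             ≈⟨ f-acts (h · inv g) n ⟩
      Δ (h · inv g) (σ n)             ≈⟨ Δ-· h (inv g) (σ n) ⟩
      Δ h (σ n) ∙ Δ (inv g) (σ n)     ≈⟨ ∙-congˡ (Δ-inv g (σ n)) ⟩
      Δ h (σ n) ∙ Δ g (σ n) ⁻¹        ≈⟨ ∙-cong (f-acts h n) (⁻¹-cong (f-acts g n)) ⟨
      Δ (f h) n ∙ Δ (f g) n ⁻¹        ≈⟨ ∙-congˡ (Δ-inv (f g) n) ⟨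
      Δ (f h) n ∙ Δ (inv (f g)) n     ≈⟨ Δ-· (f h) (inv (f g)) n ⟨
      Δ (f h · inv (f g)) n           ∎

    ActsOnΔ-involution-InS : (∀ n → σ (σ n) ≡ n) → Stable≤ m σ → ∀ {v} → InS v → InS (f v)
    ActsOnΔ-involution-InS σ-involutive σ-stable {v} (x , x≉ε , suc p , suc q , _ , s≤s p<q , s≤s q≤m , v≋block) =
      InS-resp (Δ-injective Δfv≈Δw) w∈S
      where
      σp≢σq : σ p ≢ σ q
      σp≢σq σp≡σq =
        ℕₚ.<⇒≢ p<q (≡.trans (≡.sym (σ-involutive p)) (≡.trans (≡.cong σ σp≡σq) (σ-involutive q)))
      realised = dipole-realised x≉ε σp≢σq (σ-stable (≤-trans (ℕₚ.<⇒≤ p<q) q≤m)) (σ-stable q≤m)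
      w = proj₁ realised
      w∈S = proj₁ (proj₂ realised)
      Δfv≈Δw : ∀ n → n ≤ m → Δ (f v) n ≈ Δ w n
      Δfv≈Δw n _ = begin
        Δ (f v) n                          ≈⟨ f-acts v n ⟩
        Δ v (σ n)                          ≈⟨ Δ-cong v≋block (σ n) ⟩
        Δ (block x (suc p) (suc q)) (σ n)  ≈⟨ Δ-block x p<q q≤m (σ n) ⟩
        dipole x p q (σ n)                 ≡⟨ dipole-∘-involution x p q σ-involutive n ⟩
        dipole x (σ p) (σ q) n             ≈⟨ proj₂ (proj₂ realised) n ⟨
        Δ w n                              ∎

  module Involution {f σ} (f-acts : ActsOnΔ f σ) (σ-involutive : ∀ n → σ (σ n) ≡ n) (σ-stable : Stable≤ m σ) where

    involutive : ∀ v → f (f v) ≋ v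
    involutive v = Δ-injective λ n _ →
      trans (f-acts (f v) n) (trans (f-acts v (σ n)) (≡⇒≈ (≡.cong (Δ v) (σ-involutive n))))

    isBij : IsBij f
    isBij = ActsOnΔ-cong f-acts
          , (λ {u} {v} fu≋fv j → trans (sym (involutive u j)) (trans (ActsOnΔ-cong f-acts fu≋fv j) (involutive v j)))
          , (λ v → f v , involutive v)

    isGroupAut : IsGroupAut f
    isGroupAut = isBij , ActsOnΔ-hom f-acts

    maps-S : ∀ {v} → InS v → InS (f v)
    maps-S = ActsOnΔ-involution-InS f-acts σ-involutive σ-stable

    preservesS : PreservesS f
    preservesS = (λ _ → maps-S) , (λ v v∈S → f v , maps-S v∈S , involutive v)

    isGraphAut : IsGraphAut f
    isGraphAut = isBij , λ g h →
        (λ g∼h → InS-resp (λ j → sym (ActsOnΔ-quotient f-acts g h j)) (maps-S g∼h))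
      , (λ fg∼fh → InS-resp (λ j → sym (quotient-back g h j)) (maps-S fg∼fh))
      where
      quotient-back : ∀ g h → f (f h · inv (f g)) ≋ (h · inv g)
      quotient-back g h j = trans (ActsOnΔ-quotient f-acts (f g) (f h) j)
                                  (∙-cong (involutive h j) (⁻¹-cong (involutive g j)))

  IsGraphAut-⨾ : ∀ {f h} → IsGraphAut f → IsGraphAut h → IsGraphAut (f ⨾ h)
  IsGraphAut-⨾ {f} {h} ((f-cong , f-inj , f-surj) , f-adj) ((h-cong , h-inj , h-surj) , h-adj) =
      ( h-cong ∘ f-cong
      , f-inj ∘ h-inj
      , λ v → let (u , hu≋v) = h-surj v ; (t , ft≋u) = f-surj u in
              t , λ j → trans (h-cong ft≋u j) (hu≋v j))
    , λ g g′ → (proj₁ (h-adj (f g) (f g′)) ∘ proj₁ (f-adj g g′))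
             , (proj₂ (f-adj g g′) ∘ proj₂ (h-adj (f g) (f g′)))

  module Generator (a : Fin m) = Involution (γ-acts a) (swapAdj-involutive (toℕ a)) (swapAdj-stable (toℕ<n a))

  γ-comm : ∀ a b → 1 < ∣ toℕ a - toℕ b ∣ → (γ a ⨾ γ b) ≐ (γ b ⨾ γ a)
  γ-comm a b far g = Δ-injective λ n _ → begin
    Δ ((γ a ⨾ γ b) g) n                           ≈⟨ ActsOnΔ-⨾ (γ-acts a) (γ-acts b) g n ⟩
    Δ g (swapAdj (toℕ a) (swapAdj (toℕ b) n))     ≡⟨ ≡.cong (Δ g) (swapAdj-comm (toℕ a) (toℕ b) far n) ⟩
    Δ g (swapAdj (toℕ b) (swapAdj (toℕ a) n))     ≈⟨ ActsOnΔ-⨾ (γ-acts b) (γ-acts a) g n ⟨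
    Δ ((γ b ⨾ γ a) g) n                           ∎

  γℕ-isGraphAut : ∀ {a} → a < m → IsGraphAut (γℕ a)
  γℕ-isGraphAut a<m = ≡.subst IsGraphAut (≡.sym (γℕ-< a<m)) (Generator.isGraphAut (fromℕ< a<m))

  prodRange-isGraphAut : ∀ a j → a ℕ.+ j < m → IsGraphAut (prodRange a j)
  prodRange-isGraphAut a zero    a+0<m = γℕ-isGraphAut (m+n≤o⇒m≤o (suc a) a+0<m)
  prodRange-isGraphAut a (suc j) a+j<m = IsGraphAut-⨾
    (γℕ-isGraphAut (m+n≤o⇒m≤o (suc a) a+j<m))
    (prodRange-isGraphAut (suc a) j (≡.subst (_< m) (+-suc a j) a+j<m))

  module Nontrivial {x} (x≉ε : ¬ x ≈ ε) (2≤m : 2 ≤ m) where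

    ActsOnΔ-faithful : ∀ {f h σ τ} → ActsOnΔ f σ → ActsOnΔ h τ → Stable≤ m σ → f ≐ h →
                       ∀ {n} → n ≤ m → σ n ≡ τ n
    ActsOnΔ-faithful {f} {h} {σ} {τ} f-acts h-acts σ-stable f≐h {n} n≤m with σ n ℕ.≟ τ n
    ... | yes σn≡τn = σn≡τn
    -- A dipole with poles σ n and a third point r ≤ m tells σ n apart from τ n.
    ... | no σn≢τn with avoid-two (σ n) (τ n)
    ...   | r , r≤2 , r≢σn , r≢τn = ⊥-elim (x≉ε x≈ε)
      where
      realised = dipole-realised x≉ε (r≢σn ∘ ≡.sym) (σ-stable n≤m) (≤-trans r≤2 2≤m)
      v = proj₁ realised
      Δv = proj₂ (proj₂ realised)
      x≈ε : x ≈ ε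
      x≈ε = begin
        x                       ≡⟨ dipole-at-p x (σ n) r ⟨
        dipole x (σ n) r (σ n)  ≈⟨ Δv (σ n) ⟨
        Δ v (σ n)               ≈⟨ f-acts v n ⟨
        Δ (f v) n               ≈⟨ Δ-cong (f≐h v) n ⟩
        Δ (h v) n               ≈⟨ h-acts v n ⟩
        Δ v (τ n)               ≈⟨ Δv (τ n) ⟩
        dipole x (σ n) r (τ n)  ≡⟨ dipole-elsewhere x (σn≢τn ∘ ≡.sym) (r≢τn ∘ ≡.sym) ⟩
        ε                       ∎

    order-from-action : ∀ {f σ N a} → ActsOnΔ f σ → Stable≤ m σ → 1 ≤ N → σ ^ N ≗ id → a ≤ m →
                        (∀ k → 1 ≤ k → k < N → (σ ^ k) a ≢ a) → HasOrder f N
    order-from-action {f} {σ} {N} f-acts σ-stable 1≤N σᴺ≗id a≤m a-not-fixed =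
        1≤N
      , (λ v → Δ-injective λ n _ → trans (ActsOnΔ-iter f-acts N v n) (≡⇒≈ (≡.cong (Δ v) (σᴺ≗id n))))
      , λ k 1≤k k<N fᵏ≐id →
          a-not-fixed k 1≤k k<N (ActsOnΔ-faithful (ActsOnΔ-iter f-acts k) ActsOnΔ-id (^-stable σ-stable k) fᵏ≐id a≤m)

    γ-order : ∀ a → HasOrder (γ a) 2
    γ-order a = order-from-action (γ-acts a) (swapAdj-stable (toℕ<n a)) (s≤s z≤n)
      (swapAdj-involutive (toℕ a)) (ℕₚ.<⇒≤ (toℕ<n a)) moves-a
      where
      moves-a : ∀ k → 1 ≤ k → k < 2 → (swapAdj (toℕ a) ^ k) (toℕ a) ≢ toℕ a
      moves-a 1      _ _                = ℕₚ.1+n≢n ∘ ≡.trans (≡.sym (swapAdj-self (toℕ a)))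
      moves-a (2+ _) _ (s≤s (s≤s ()))

    prodRange-order : ∀ a j → a ℕ.+ j < m → HasOrder (prodRange a j) (j ℕ.+ 2)
    prodRange-order a j a+j<m = ≡.subst (HasOrder (prodRange a j)) (+-comm 2 j)
      (order-from-action (prodRange-acts a j a+j<m) (cycle-stable a j a+j<m) (s≤s z≤n)
        (cycle-period a j) (m+n≤o⇒m≤o a (ℕₚ.<⇒≤ a+j<m)) moves-a)
      where
      moves-a : ∀ k → 1 ≤ k → k < 2 ℕ.+ j → (cycle a j ^ k) a ≢ a
      moves-a (suc k) _ (s≤s 1+k≤1+j) = ℕₚ.m+1+n≢m a ∘ ≡.trans (≡.sym (cycle-orbit a j (suc k) 1+k≤1+j))

    Γ≅Sym : GammaIsoSym
    Γ≅Sym = evalWord , evalWord-++ , well-defined , injective , evalWord-surjective m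
      where
      well-defined : ∀ w w′ → word w ≐ word w′ → evalWord w ≈ₚ evalWord w′
      well-defined w w′ w≐w′ =
        swapsℕ⇒evalWord-≈ w w′ (ActsOnΔ-faithful (word-acts w) (word-acts w′) (swapsℕ-stable w) w≐w′)
      injective : ∀ w w′ → evalWord w ≈ₚ evalWord w′ → word w ≐ word w′
      injective w w′ w≈w′ g = Δ-injective λ n n≤m → begin
        Δ (word w g) n        ≈⟨ word-acts w g n ⟩
        Δ g (swapsℕ w n)      ≡⟨ ≡.cong (Δ g) (evalWord-≈⇒swapsℕ w w′ w≈w′ n≤m) ⟩
        Δ g (swapsℕ w′ n)     ≈⟨ word-acts w′ g n ⟨
        Δ (word w′ g) n       ∎

lemma6p1 : ∀ {c ℓ} (G : AbelianGroup c ℓ) →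
    IsFiniteSetoid (AbelianGroup.setoid G) →
    Σ (AbelianGroup.Carrier G) (λ x → ¬ (AbelianGroup._≈_ G x (AbelianGroup.ε G))) →
    (m : ℕ) → 2 ≤ m →
    let open Cayley G m in
      (∀ (i : Fin m) → IsGroupAut (γ i) × HasOrder (γ i) 2 × PreservesS (γ i) × IsGraphAut (γ i))
    × (∀ (i j : Fin m) → 1 < ∣ toℕ i - toℕ j ∣ → (γ i ⨾ γ j) ≐ (γ j ⨾ γ i))
    × (∀ (i : Fin m) (j : ℕ) → 1 ≤ j → toℕ i + j < m →
         IsGraphAut (prodRange (toℕ i) j) × HasOrder (prodRange (toℕ i) j) (j + 2))
    × (∀ (i : Fin m) → suc (toℕ i) < m → HasOrder (prodRange (toℕ i) 1) 3)
    × HasOrder (prodRange 0 (m ∸ 1)) (suc m)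
    × GammaIsoSym
lemma6p1 G _ (x , x≉ε) m 2≤m =
    (λ i → Generator.isGroupAut i , γ-order i , Generator.preservesS i , Generator.isGraphAut i)
  , γ-comm
  , (λ i j _ i+j<m → prodRange-isGraphAut (toℕ i) j i+j<m , prodRange-order (toℕ i) j i+j<m)
  , (λ i 2+i≤m → prodRange-order (toℕ i) 1 (≡.subst (_< m) (+-comm 1 (toℕ i)) 2+i≤m))
  , ≡.subst (HasOrder (prodRange 0 (m ∸ 1))) (≡.trans (+-comm (m ∸ 1) 2) (≡.cong suc 1+[m∸1]≡m))
          (prodRange-order 0 (m ∸ 1) (≤-reflexive 1+[m∸1]≡m))
  , Γ≅Sym
  where
  open Cayley G m
  open Differences G m
  open Nontrivial x≉ε 2≤m
  1+[m∸1]≡m : 1 + (m ∸ 1) ≡ m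
  1+[m∸1]≡m = m+[n∸m]≡n {1} {m} (≤-trans (s≤s z≤n) 2≤m)
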